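{- Let $\mathbb{A}$ be as follows: $\sigma_0$ is a finite relational vocabulary of unary and binary symbols, $\mathscr{C}_0$ is a free amalgamation class of finite irreflexive $\sigma_0$-structures, $\mathscr{C}$ is the class of all expansions of structures in $\mathscr{C}_0$ by an arbitrary total order $<$, and $\mathbb{A}$ is the Fraïssé limit of $\mathscr{C}$. Let $X,Y,\{z\}\subseteq\mathbb{A}$ be pairwise disjoint finite sets. Then there is an automorphism $\tau$ of $\mathbb{A}$ such that (1) $\tau$ fixes every $x\in X$; (2) $\tau(z)$ is unrelated to every $y\in Y$ and unrelated to $z$; (3) $\tau(z)>z$.
   Context: Two elements $x,y$ are related if $x=y$ or $R(x,y)$ or $R(y,x)$ for some binary $R\in\sigma_0$; unrelated means not related. Irreflexive: $R(x,y)$ implies $x\neq y$ for binary $R\in\sigma_0$. A free amalgamation class is a class $\operatorname{Forb}(\mathscr{F})$ of all finite $\sigma_0$-structures embedding no member of $\mathscr{F}$, where $\mathscr{F}$ is a family of finite $\sigma_0$-structures in each of which every two elements are related. The Fraïssé limit of $\mathscr{C}$ is the unique countable homogeneous $(\sigma_0\uplus\{<\})$-structure whose finite substructures are, up to isomorphism, exactly those of $\mathscr{C}$. -}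

module Defs where

open import Data.Nat using (ℕ)
open import Data.Fin using (Fin)
open import Data.Product using (Σ; _×_; ∃)
open import Data.Sum using (_⊎_)
open import Data.List using (List)
open import Data.List.Membership.Propositional using (_∈_)
open import Relation.Nullary using (¬_)
open import Relation.Binary.PropositionalEquality using (_≡_; _≢_)
open import Function.Bundles using (_⇔_)
open import Function.Definitions using (Injective; Bijective)

record Str (nU nB : ℕ) (D : Set) : Set₁ where
  field
    U : Fin nU → D → Set
    B : Fin nB → D → D → Set
open Str public

record OStr (nU nB : ℕ) (D : Set) : Set₁ where
  field
    str : Str nU nB D
    lt  : D → D → Set
open OStr public

record FinStr (nU nB : ℕ) : Set₁ where
  field
    size : ℕ
    st   : Str nU nB (Fin size)
open FinStr public

module _ {nU nB : ℕ} where

  IsEmbedding : {D E : Set} → Str nU nB D → Str nU nB E → (D → E) → Set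
  IsEmbedding S T f =
    Injective _≡_ _≡_ f
    × (∀ u x → U S u x ⇔ U T u (f x))
    × (∀ r x y → B S r x y ⇔ B T r (f x) (f y))

  IsOEmbedding : {D E : Set} → OStr nU nB D → OStr nU nB E → (D → E) → Set
  IsOEmbedding S T f =
    IsEmbedding (str S) (str T) f × (∀ x y → lt S x y ⇔ lt T (f x) (f y))

  Related : {D : Set} → Str nU nB D → D → D → Set
  Related S x y = x ≡ y ⊎ Σ (Fin nB) (λ r → B S r x y ⊎ B S r y x)

  Unrelated : {D : Set} → Str nU nB D → D → D → Set
  Unrelated S x y = ¬ Related S x y

  AllRelated : {D : Set} → Str nU nB D → Set
  AllRelated {D} S = ∀ (x y : D) → Related S x y

  Irreflexive : {D : Set} → Str nU nB D → Set
  Irreflexive {D} S = ∀ r (x y : D) → B S r x y → x ≢ y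

  InForb : {I : Set} → (I → FinStr nU nB) → {n : ℕ} → Str nU nB (Fin n) → Set
  InForb 𝓕 {n} S = ∀ i → ¬ Σ (Fin (size (𝓕 i)) → Fin n) (λ f → IsEmbedding (st (𝓕 i)) S f)

  StrictTotal : {D : Set} → (D → D → Set) → Set
  StrictTotal {D} _<_ =
    (∀ x → ¬ (x < x))
    × (∀ x y z → x < y → y < z → x < z)
    × (∀ x y → x ≢ y → (x < y) ⊎ (y < x))

  -- 𝓒 : expansions of members of 𝓒₀ = Forb(𝓕) by an arbitrary total order
  InC : {I : Set} → (I → FinStr nU nB) → {n : ℕ} → OStr nU nB (Fin n) → Set
  InC 𝓕 S = InForb 𝓕 (str S) × StrictTotal (lt S)

  Automorphism : {D : Set} → OStr nU nB D → (D → D) → Set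
  Automorphism A τ = Bijective _≡_ _≡_ τ × IsOEmbedding A A τ

  SameType : {D : Set} → OStr nU nB D → {n : ℕ} → (Fin n → D) → (Fin n → D) → Set
  SameType A f g =
    (∀ u i → U (str A) u (f i) ⇔ U (str A) u (g i))
    × (∀ r i j → B (str A) r (f i) (f j) ⇔ B (str A) r (g i) (g j))
    × (∀ i j → lt A (f i) (f j) ⇔ lt A (g i) (g j))

  Countable : Set → Set
  Countable D = Σ (D → ℕ) (λ e → Injective _≡_ _≡_ e)

  AgeIs : {I : Set} → (I → FinStr nU nB) → {D : Set} → OStr nU nB D → Set₁
  AgeIs 𝓕 {D} A = ∀ (n : ℕ) (S : OStr nU nB (Fin n)) →
    InC 𝓕 S ⇔ Σ (Fin n → D) (λ f → IsOEmbedding S A f)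

  Homogeneous : {D : Set} → OStr nU nB D → Set
  Homogeneous {D} A = ∀ (n : ℕ) (f g : Fin n → D) →
    Injective _≡_ _≡_ f → Injective _≡_ _≡_ g → SameType A f g →
    Σ (D → D) (λ τ → Automorphism A τ × (∀ i → τ (f i) ≡ g i))

  IsFraisseLimit : {I : Set} → (I → FinStr nU nB) → {D : Set} → OStr nU nB D → Set₁
  IsFraisseLimit 𝓕 {D} A = Countable D × AgeIs 𝓕 A × Homogeneous A


Disjoint : {D : Set} → List D → List D → Set
Disjoint X Y = ∀ x → x ∈ X → ¬ (x ∈ Y)

-- The automorphism is built in two homogeneity steps. First, free amalgamation
-- lets us adjoin to the finite set {z} ∪ X ∪ Y a copy z* of z, placed immediately
-- above z in the order, that is related to the points of X exactly as z is and to
-- nothing else: every forbidden structure is pairwise related, so an embedding of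
-- one into the extension never uses both z* and a point it is unrelated to, and
-- merging z* with z turns it into an embedding into 𝔸. The extension lies in the
-- age, and homogeneity realises it over {z} ∪ X ∪ Y inside 𝔸. Second, z and z*
-- have the same type over X, so homogeneity moves z to z* while fixing X.
module Submission where

open import Defs
open import Data.Nat using (ℕ)
open import Data.Fin using (Fin)
open import Data.Product using (Σ; _×_)
open import Data.List using (List)
open import Data.List.Membership.Propositional using (_∈_; _∉_)
open import Relation.Binary.PropositionalEquality using (_≡_)

import Data.Nat as ℕ
open import Data.Fin using (zero; suc; _≟_)
open import Data.Nat.Properties using (eq?)
open import Data.Fin.Properties using (0≢1+n; suc-injective)
open import Data.Vec.Functional using () renaming (_∷_ to _∷ᵥ_)
open import Data.Product using (_,_; proj₁; proj₂; ∃)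
open import Data.Sum using (_⊎_; inj₁; inj₂; [_,_]; map₁; map₂)
open import Data.Empty using (⊥; ⊥-elim)
open import Data.Unit using (⊤; tt)
open import Data.List using (_∷_; _++_; lookup; length; deduplicate)
open import Data.List.Membership.Propositional.Properties
  using (∈-deduplicate⁺; ∈-deduplicate⁻; ∈-lookup; ∈-++⁺ˡ; ∈-++⁺ʳ)
open import Data.List.Relation.Unary.Any using (here; there; index)
open import Data.List.Relation.Unary.Any.Properties using (lookup-index)
import Data.List.Relation.Unary.All as All
open import Data.List.Relation.Unary.AllPairs using (_∷_)
open import Data.List.Relation.Unary.Unique.Propositional using (Unique)
import Data.List.Relation.Unary.Unique.DecPropositional.Properties as UniqueDec
open import Relation.Nullary using (¬_; yes; no)
open import Relation.Binary.PropositionalEquality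
  using (refl; sym; trans; cong; subst; _≢_; _≗_)
open import Relation.Binary.Definitions using (DecidableEquality)
open import Relation.Binary.Structures using (IsEquivalence)
open import Function using (id; _∘_)
open import Function.Bundles using (_⇔_; mk⇔; mk↣; Equivalence)
open import Function.Definitions using (Injective)
open import Function.Properties.Equivalence using (⇔-isEquivalence)

open import Level using (0ℓ)

open Equivalence using (to; from)
open IsEquivalence (⇔-isEquivalence {ℓ = 0ℓ})
  renaming (refl to ⇔-refl; sym to ⇔-sym; trans to ⇔-trans)

subst-⇔ : {D : Set} (P : D → Set) {x y : D} → x ≡ y → P x ⇔ P y
subst-⇔ P refl = ⇔-refl

Unique⇒lookup-injective : {D : Set} {xs : List D} → Unique xs → Injective _≡_ _≡_ (lookup xs)
Unique⇒lookup-injective (x≢xs ∷ u) {zero}  {zero}  _ = refl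
Unique⇒lookup-injective (x≢xs ∷ u) {zero}  {suc j} e = ⊥-elim (All.lookup x≢xs (∈-lookup j) e)
Unique⇒lookup-injective (x≢xs ∷ u) {suc i} {zero}  e = ⊥-elim (All.lookup x≢xs (∈-lookup i) (sym e))
Unique⇒lookup-injective (x≢xs ∷ u) {suc i} {suc j} e = cong suc (Unique⇒lookup-injective u e)

record Enumeration {D : Set} (xs : List D) : Set where
  field
    count     : ℕ
    enum      : Fin count → D
    injective : Injective _≡_ _≡_ enum
    sound     : ∀ i → enum i ∈ xs
    complete  : ∀ {x} → x ∈ xs → ∃ λ i → enum i ≡ x

  complete-∀ : {Q : D → Set} → (∀ i → Q (enum i)) → ∀ {x} → x ∈ xs → Q x
  complete-∀ {Q} q x∈xs = subst Q (proj₂ (complete x∈xs)) (q (proj₁ (complete x∈xs)))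

enumerate : {D : Set} → DecidableEquality D → (xs : List D) → Enumeration xs
enumerate _≟D_ xs = record
  { count     = length ys
  ; enum      = lookup ys
  ; injective = Unique⇒lookup-injective (UniqueDec.deduplicate-! _≟D_ xs)
  ; sound     = λ i → ∈-deduplicate⁻ _≟D_ xs (∈-lookup i)
  ; complete  = λ x∈xs → let p = ∈-deduplicate⁺ _≟D_ x∈xs in index p , sym (lookup-index p)
  }
  where ys = deduplicate _≟D_ xs

∷-injective : {D : Set} {n : ℕ} {a : D} {g : Fin n → D} →
  Injective _≡_ _≡_ g → (∀ i → a ≢ g i) → Injective _≡_ _≡_ (a ∷ᵥ g)
∷-injective g-inj a-fresh {zero}  {zero}  _ = refl
∷-injective g-inj a-fresh {zero}  {suc j} e = ⊥-elim (a-fresh j e)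
∷-injective g-inj a-fresh {suc i} {zero}  e = ⊥-elim (a-fresh i (sym e))
∷-injective g-inj a-fresh {suc i} {suc j} e = cong suc (g-inj e)

insertAfter : {m : ℕ} → (Fin m → Fin m → Set) → Fin m → Fin (ℕ.suc m) → Fin (ℕ.suc m) → Set
insertAfter _<_ k zero    zero    = ⊥
insertAfter _<_ k zero    (suc j) = k < j
insertAfter _<_ k (suc i) zero    = i < k ⊎ i ≡ k
insertAfter _<_ k (suc i) (suc j) = i < j

insertAfter-below : {m : ℕ} {_<_ : Fin m → Fin m → Set} {k i : Fin m} →
  i ≢ k → insertAfter _<_ k (suc i) zero ⇔ i < k
insertAfter-below i≢k = mk⇔ [ id , ⊥-elim ∘ i≢k ] inj₁

Attached : {m : ℕ} → (Fin m → Set) → Fin (ℕ.suc m) → Fin (ℕ.suc m) → Set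
Attached P zero    zero    = ⊤
Attached P zero    (suc j) = P j
Attached P (suc i) zero    = P i
Attached P (suc i) (suc j) = ⊤

Attached-refl : {m : ℕ} {P : Fin m → Set} → ∀ x → Attached P x x
Attached-refl zero    = tt
Attached-refl (suc i) = tt

Attached-sym : {m : ℕ} {P : Fin m → Set} → ∀ x y → Attached P x y → Attached P y x
Attached-sym zero    zero    a = a
Attached-sym zero    (suc j) a = a
Attached-sym (suc i) zero    a = a
Attached-sym (suc i) (suc j) a = a

module _ {nU nB : ℕ} where

  induced : {D E : Set} → OStr nU nB D → (E → D) → OStr nU nB E
  induced A g = record
    { str = record { U = λ u i → U (str A) u (g i) ; B = λ r i j → B (str A) r (g i) (g j) }
    ; lt  = λ i j → lt A (g i) (g j) }

  induced-isOEmbedding : {D E : Set} (A : OStr nU nB D) {g : E → D} →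
    Injective _≡_ _≡_ g → IsOEmbedding (induced A g) A g
  induced-isOEmbedding A g-inj =
    (g-inj , (λ _ _ → ⇔-refl) , (λ _ _ _ → ⇔-refl)) , (λ _ _ → ⇔-refl)

  IsOEmbedding-∘ : {D E F : Set} {S : OStr nU nB D} {T : OStr nU nB E} {R : OStr nU nB F}
    {f : D → E} {h : E → F} → IsOEmbedding S T f → IsOEmbedding T R h → IsOEmbedding S R (h ∘ f)
  IsOEmbedding-∘ ((f-inj , fU , fB) , flt) ((h-inj , hU , hB) , hlt) =
    ( f-inj ∘ h-inj
    , (λ u x → ⇔-trans (fU u x) (hU u _))
    , (λ r x y → ⇔-trans (fB r x y) (hB r _ _)))
    , (λ x y → ⇔-trans (flt x y) (hlt _ _))

  IsOEmbedding-resp-≗ : {D E : Set} {S : OStr nU nB D} {T : OStr nU nB E} {f f′ : D → E} →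
    f ≗ f′ → IsOEmbedding S T f → IsOEmbedding S T f′
  IsOEmbedding-resp-≗ {D} {E} {T = T} {f} {f′} f≗f′ ((f-inj , fU , fB) , flt) =
    ( (λ e → f-inj (trans (f≗f′ _) (trans e (sym (f≗f′ _)))))
    , (λ u x → ⇔-trans (fU u x) (subst-⇔ (U (str T) u) (f≗f′ x)))
    , (λ r x y → ⇔-trans (fB r x y) (both (B (str T) r) x y)))
    , (λ x y → ⇔-trans (flt x y) (both (lt T) x y))
    where
    both : (R : E → E → Set) (x y : D) → R (f x) (f y) ⇔ R (f′ x) (f′ y)
    both R x y = ⇔-trans (subst-⇔ (λ w → R w (f y)) (f≗f′ x)) (subst-⇔ (R (f′ x)) (f≗f′ y))

  IsEmbedding⇒Related : {D E : Set} {S : Str nU nB D} {T : Str nU nB E} {f : D → E} →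
    IsEmbedding S T f → ∀ {x y} → Related S x y → Related T (f x) (f y)
  IsEmbedding⇒Related _            (inj₁ refl)            = inj₁ refl
  IsEmbedding⇒Related (_ , _ , fB) {x} {y} (inj₂ (r , inj₁ Rxy)) = inj₂ (r , inj₁ (to (fB r x y) Rxy))
  IsEmbedding⇒Related (_ , _ , fB) {x} {y} (inj₂ (r , inj₂ Ryx)) = inj₂ (r , inj₂ (to (fB r y x) Ryx))

  -- An embedding on related pairs, which is all that a pairwise related structure can see.
  record IsLocalEmbedding {D E : Set} (S : Str nU nB D) (T : Str nU nB E) (h : D → E) : Set where
    field
      unary     : ∀ u x → U S u x ⇔ U T u (h x)
      injective : ∀ {x y} → Related S x y → h x ≡ h y → x ≡ y
      binary    : ∀ r {x y} → Related S x y → B S r x y ⇔ B T r (h x) (h y)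

  AllRelated-∘ : {F D E : Set} {P : Str nU nB F} {S : Str nU nB D} {T : Str nU nB E}
    {f : F → D} {h : D → E} → AllRelated P → IsEmbedding P S f → IsLocalEmbedding S T h →
    IsEmbedding P T (h ∘ f)
  AllRelated-∘ {P = P} {S = S} {f = f} all emb@(f-inj , fU , fB) loc =
    ( (λ {a} {b} e → f-inj (injective (related a b) e))
    , (λ u a → ⇔-trans (fU u a) (unary u (f a)))
    , (λ r a b → ⇔-trans (fB r a b) (binary r (related a b))))
    where
    open IsLocalEmbedding loc
    related : ∀ a b → Related S (f a) (f b)
    related a b = IsEmbedding⇒Related {S = P} {T = S} emb (all a b)

  InForb-pullback : {I : Set} {𝓕 : I → FinStr nU nB} → (∀ i → AllRelated (st (𝓕 i))) →
    {n m : ℕ} {S : Str nU nB (Fin n)} {T : Str nU nB (Fin m)} {h : Fin n → Fin m} →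
    IsLocalEmbedding S T h → InForb 𝓕 T → InForb 𝓕 S
  InForb-pullback allRelated loc T∈Forb i (f , emb) =
    T∈Forb i (_ , AllRelated-∘ (allRelated i) emb loc)

  insertAfter-strictTotal : {m : ℕ} {_<_ : Fin m → Fin m → Set} (k : Fin m) →
    StrictTotal {nU} {nB} _<_ → StrictTotal {nU} {nB} (insertAfter _<_ k)
  insertAfter-strictTotal {_<_ = _<_} k (irr , tra , tot) = irr′ , tra′ , tot′
    where
    _<′_ = insertAfter _<_ k

    irr′ : ∀ x → ¬ (x <′ x)
    irr′ zero    ()
    irr′ (suc i) = irr i

    tra′ : ∀ x y w → x <′ y → y <′ w → x <′ w
    tra′ zero    zero    w       ()       _
    tra′ zero    (suc j) zero    k<j      (inj₁ j<k)  = irr k (tra k j k k<j j<k)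
    tra′ zero    (suc j) zero    k<j      (inj₂ refl) = irr j k<j
    tra′ zero    (suc j) (suc l) k<j      j<l         = tra k j l k<j j<l
    tra′ (suc i) zero    zero    _        ()
    tra′ (suc i) zero    (suc l) (inj₁ i<k)  k<l      = tra i k l i<k k<l
    tra′ (suc i) zero    (suc l) (inj₂ refl) k<l      = k<l
    tra′ (suc i) (suc j) zero    i<j      (inj₁ j<k)  = inj₁ (tra i j k i<j j<k)
    tra′ (suc i) (suc j) zero    i<j      (inj₂ refl) = inj₁ i<j
    tra′ (suc i) (suc j) (suc l) i<j      j<l         = tra i j l i<j j<l

    tot′ : ∀ x y → x ≢ y → x <′ y ⊎ y <′ x
    tot′ zero    zero    x≢y = ⊥-elim (x≢y refl)
    tot′ zero    (suc j) _   with j ≟ k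
    ... | yes refl = inj₂ (inj₂ refl)
    ... | no  j≢k  = map₂ inj₁ (tot k j (j≢k ∘ sym))
    tot′ (suc i) zero    _   with i ≟ k
    ... | yes refl = inj₁ (inj₂ refl)
    ... | no  i≢k  = map₁ inj₁ (tot i k i≢k)
    tot′ (suc i) (suc j) i≢j = tot i j (i≢j ∘ cong suc)

  -- The new point zero copies k, sits immediately above k, and is attached only to
  -- the points suc j with P j.
  freeCopy : {m : ℕ} → OStr nU nB (Fin m) → Fin m → (Fin m → Set) → OStr nU nB (Fin (ℕ.suc m))
  freeCopy T k P = record
    { str = record
      { U = λ u x → U (str T) u ((k ∷ᵥ id) x)
      ; B = λ r x y → B (str T) r ((k ∷ᵥ id) x) ((k ∷ᵥ id) y) × Attached P x y }
    ; lt  = insertAfter (lt T) k }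

  module _ {m : ℕ} {T : OStr nU nB (Fin m)} {k : Fin m} {P : Fin m → Set} where

    freeCopy-Related⇒Attached : ∀ {x y} → Related (str (freeCopy T k P)) x y → Attached P x y
    freeCopy-Related⇒Attached {x} (inj₁ refl)                 = Attached-refl x
    freeCopy-Related⇒Attached     (inj₂ (_ , inj₁ (_ , a)))   = a
    freeCopy-Related⇒Attached {x} {y} (inj₂ (_ , inj₂ (_ , a))) = Attached-sym y x a

    freeCopy-collapse : ¬ P k → IsLocalEmbedding (str (freeCopy T k P)) (str T) (k ∷ᵥ id)
    freeCopy-collapse ¬Pk = record
      { unary     = λ _ _ → ⇔-refl
      ; injective = λ rel → collapse-injective _ _ (freeCopy-Related⇒Attached rel)
      ; binary    = λ _ rel → mk⇔ proj₁ (_, freeCopy-Related⇒Attached rel)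
      }
      where
      collapse-injective : ∀ x y → Attached P x y → (k ∷ᵥ id) x ≡ (k ∷ᵥ id) y → x ≡ y
      collapse-injective zero    zero    _  _    = refl
      collapse-injective zero    (suc j) Pj refl = ⊥-elim (¬Pk Pj)
      collapse-injective (suc i) zero    Pi refl = ⊥-elim (¬Pk Pi)
      collapse-injective (suc i) (suc j) _  i≡j  = cong suc i≡j

    freeCopy-restrict : IsOEmbedding (induced (freeCopy T k P) suc) T id
    freeCopy-restrict = (id , (λ _ _ → ⇔-refl) , (λ _ _ _ → mk⇔ proj₁ (_, tt))) , (λ _ _ → ⇔-refl)

    freeCopy-InC : {I : Set} {𝓕 : I → FinStr nU nB} → (∀ i → AllRelated (st (𝓕 i))) →
      ¬ P k → InC 𝓕 T → InC 𝓕 (freeCopy T k P)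
    freeCopy-InC allRelated ¬Pk (T∈Forb , <-strictTotal) =
        InForb-pullback allRelated (freeCopy-collapse ¬Pk) T∈Forb
      , insertAfter-strictTotal k <-strictTotal

  IsOEmbedding⇒SameType : {D : Set} {A : OStr nU nB D} {n : ℕ} {S : OStr nU nB (Fin n)}
    {f g : Fin n → D} → IsOEmbedding S A f → IsOEmbedding S A g → SameType A f g
  IsOEmbedding⇒SameType ((_ , fU , fB) , flt) ((_ , gU , gB) , glt) =
      (λ u i → ⇔-trans (⇔-sym (fU u i)) (gU u i))
    , (λ r i j → ⇔-trans (⇔-sym (fB r i j)) (gB r i j))
    , (λ i j → ⇔-trans (⇔-sym (flt i j)) (glt i j))

  record SameTypeOver {D : Set} (A : OStr nU nB D) (X : List D) (z z′ : D) : Set where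
    field
      unary   : ∀ u → U (str A) u z ⇔ U (str A) u z′
      B-loop  : ∀ r → B (str A) r z z ⇔ B (str A) r z′ z′
      B-out   : ∀ r {x} → x ∈ X → B (str A) r z x ⇔ B (str A) r z′ x
      B-into  : ∀ r {x} → x ∈ X → B (str A) r x z ⇔ B (str A) r x z′
      lt-loop : lt A z z ⇔ lt A z′ z′
      lt-out  : ∀ {x} → x ∈ X → lt A z x ⇔ lt A z′ x
      lt-into : ∀ {x} → x ∈ X → lt A x z ⇔ lt A x z′

module FraisseLimit {nU nB : ℕ} {I : Set} {𝓕 : I → FinStr nU nB} {D : Set} {A : OStr nU nB D}
  (lim : IsFraisseLimit 𝓕 A) where

  private
    age : AgeIs 𝓕 A
    age = proj₁ (proj₂ lim)

    homogeneous : Homogeneous A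
    homogeneous = proj₂ (proj₂ lim)

  _≟D_ : DecidableEquality D
  _≟D_ = eq? (mk↣ (proj₂ (proj₁ lim)))

  induced-InC : {m : ℕ} {g : Fin m → D} → Injective _≡_ _≡_ g → InC 𝓕 (induced A g)
  induced-InC g-inj = from (age _ _) (_ , induced-isOEmbedding A g-inj)

  realise : {m : ℕ} (S : OStr nU nB (Fin (ℕ.suc m))) {g : Fin m → D} → InC 𝓕 S →
    IsOEmbedding (induced S suc) A g → ∃ λ d → IsOEmbedding S A (d ∷ᵥ g)
  realise {m} S {g} S∈C g-emb =
    σ (f zero) , IsOEmbedding-resp-≗ {T = A} σf≗ (IsOEmbedding-∘ {T = A} {R = A} f-emb σ-emb)
    where
    f : Fin (ℕ.suc m) → D
    f = proj₁ (to (age _ S) S∈C)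
    f-emb : IsOEmbedding S A f
    f-emb = proj₂ (to (age _ S) S∈C)
    f∘suc-emb : IsOEmbedding (induced S suc) A (f ∘ suc)
    f∘suc-emb = IsOEmbedding-∘ {T = S} {R = A} (induced-isOEmbedding S suc-injective) f-emb
    moved : Σ (D → D) λ σ → Automorphism A σ × (∀ i → σ (f (suc i)) ≡ g i)
    moved = homogeneous _ (f ∘ suc) g (proj₁ (proj₁ f∘suc-emb)) (proj₁ (proj₁ g-emb))
              (IsOEmbedding⇒SameType {A = A} {S = induced S suc} f∘suc-emb g-emb)
    σ : D → D
    σ = proj₁ moved
    σ-emb : IsOEmbedding A A σ
    σ-emb = proj₂ (proj₁ (proj₂ moved))
    σf≗ : σ ∘ f ≗ σ (f zero) ∷ᵥ g
    σf≗ zero    = refl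
    σf≗ (suc i) = proj₂ (proj₂ moved) i

  moveOver : {X : List D} {z z′ : D} → z ∉ X → z′ ∉ X → SameTypeOver A X z z′ →
    Σ (D → D) λ τ → Automorphism A τ × (∀ x → x ∈ X → τ x ≡ x) × τ z ≡ z′
  moveOver {X} {z} {z′} z∉X z′∉X same =
      τ
    , proj₁ (proj₂ moved)
    , (λ _ → complete-∀ (λ i → proj₂ (proj₂ moved) (suc i)))
    , proj₂ (proj₂ moved) zero
    where
    open Enumeration (enumerate _≟D_ X)
    open SameTypeOver same

    fresh-∷-injective : ∀ {w} → w ∉ X → Injective _≡_ _≡_ (w ∷ᵥ enum)
    fresh-∷-injective w∉X = ∷-injective injective λ i w≡ → w∉X (subst (_∈ X) (sym w≡) (sound i))

    sameType : SameType A (z ∷ᵥ enum) (z′ ∷ᵥ enum)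
    sameType = sameU , sameB , sameLt
      where
      sameU : ∀ u i → U (str A) u ((z ∷ᵥ enum) i) ⇔ U (str A) u ((z′ ∷ᵥ enum) i)
      sameU u zero    = unary u
      sameU u (suc i) = ⇔-refl
      sameB : ∀ r i j → B (str A) r ((z ∷ᵥ enum) i) ((z ∷ᵥ enum) j)
                      ⇔ B (str A) r ((z′ ∷ᵥ enum) i) ((z′ ∷ᵥ enum) j)
      sameB r zero    zero    = B-loop r
      sameB r zero    (suc j) = B-out r (sound j)
      sameB r (suc i) zero    = B-into r (sound i)
      sameB r (suc i) (suc j) = ⇔-refl
      sameLt : ∀ i j → lt A ((z ∷ᵥ enum) i) ((z ∷ᵥ enum) j)
                     ⇔ lt A ((z′ ∷ᵥ enum) i) ((z′ ∷ᵥ enum) j)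
      sameLt zero    zero    = lt-loop
      sameLt zero    (suc j) = lt-out (sound j)
      sameLt (suc i) zero    = lt-into (sound i)
      sameLt (suc i) (suc j) = ⇔-refl

    moved : Σ (D → D) λ τ → Automorphism A τ × (∀ i → τ ((z ∷ᵥ enum) i) ≡ (z′ ∷ᵥ enum) i)
    moved = homogeneous _ (z ∷ᵥ enum) (z′ ∷ᵥ enum)
              (fresh-∷-injective z∉X) (fresh-∷-injective z′∉X) sameType
    τ : D → D
    τ = proj₁ moved

  module Realisation {m : ℕ} {g : Fin m → D} {k : Fin m} {P : Fin m → Set} {d : D}
    (emb : IsOEmbedding (freeCopy (induced A g) k P) A (d ∷ᵥ g)) where

    private
      S : OStr nU nB (Fin (ℕ.suc m))
      S = freeCopy (induced A g) k P

      eU : ∀ u x → U (str S) u x ⇔ U (str A) u ((d ∷ᵥ g) x)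
      eU = proj₁ (proj₂ (proj₁ emb))

      eB : ∀ r x y → B (str S) r x y ⇔ B (str A) r ((d ∷ᵥ g) x) ((d ∷ᵥ g) y)
      eB = proj₂ (proj₂ (proj₁ emb))

      elt : ∀ x y → lt S x y ⇔ lt A ((d ∷ᵥ g) x) ((d ∷ᵥ g) y)
      elt = proj₂ emb

    fresh : ∀ j → d ≢ g j
    fresh j d≡gj = 0≢1+n (proj₁ (proj₁ emb) d≡gj)

    unrelated : ∀ j → ¬ P j → Unrelated (str A) d (g j)
    unrelated j _   (inj₁ d≡gj)         = fresh j d≡gj
    unrelated j ¬Pj (inj₂ (r , inj₁ b)) = ¬Pj (proj₂ (from (eB r zero (suc j)) b))
    unrelated j ¬Pj (inj₂ (r , inj₂ b)) = ¬Pj (proj₂ (from (eB r (suc j) zero) b))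

    above : lt A (g k) d
    above = to (elt (suc k) zero) (inj₂ refl)

    sameTypeOver : {X : List D} → (∀ {x} → x ∈ X → ∃ λ j → P j × g j ≡ x) → ¬ P k →
      ¬ lt A (g k) (g k) → SameTypeOver A X (g k) d
    sameTypeOver {X} locate ¬Pk irr = record
      { unary   = λ u → eU u zero
      ; B-loop  = λ r → ⇔-trans (mk⇔ (_, tt) proj₁) (eB r zero zero)
      ; B-out   = λ r → via λ j Pj → ⇔-trans (mk⇔ (_, Pj) proj₁) (eB r zero (suc j))
      ; B-into  = λ r → via λ j Pj → ⇔-trans (mk⇔ (_, Pj) proj₁) (eB r (suc j) zero)
      ; lt-loop = mk⇔ (⊥-elim ∘ irr) (⊥-elim ∘ from (elt zero zero))
      ; lt-out  = via λ j _ → elt zero (suc j)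
      ; lt-into = via λ j Pj → ⇔-trans (⇔-sym (insertAfter-below {_<_ = lt (induced A g)}
                                                     (λ { refl → ¬Pk Pj })))
                                        (elt (suc j) zero)
      }
      where
      via : {Q : D → Set} → (∀ j → P j → Q (g j)) → ∀ {x} → x ∈ X → Q x
      via q x∈X with locate x∈X
      ... | j , Pj , refl = q j Pj

  record FreeCopy (X Y : List D) (z : D) : Set where
    field
      copy        : D
      sameType    : SameTypeOver A X z copy
      above       : lt A z copy
      copy∉X      : copy ∉ X
      unrelated-z : Unrelated (str A) copy z
      unrelated-Y : ∀ {y} → y ∈ Y → y ∉ X → Unrelated (str A) copy y

  freeCopyOver : (∀ i → AllRelated (st (𝓕 i))) → (X Y : List D) {z : D} → z ∉ X → FreeCopy X Y z
  freeCopyOver allRelated X Y {z} z∉X = record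
    { copy        = d
    ; sameType    = subst (λ w → SameTypeOver A X w d) gk≡z
                      (sameTypeOver locate ¬Pk (proj₁ (proj₂ T∈C) k))
    ; above       = subst (λ w → lt A w d) gk≡z above
    ; copy∉X      = λ d∈X → complete-∀ {Q = d ≢_} fresh (there (∈-++⁺ˡ d∈X)) refl
    ; unrelated-z = subst (Unrelated (str A) d) gk≡z (unrelated k ¬Pk)
    ; unrelated-Y = λ y∈Y → complete-∀ unrelated (there (∈-++⁺ʳ X y∈Y))
    }
    where
    open Enumeration (enumerate _≟D_ (z ∷ X ++ Y))

    k : Fin count
    k = proj₁ (complete (here refl))
    gk≡z : enum k ≡ z
    gk≡z = proj₂ (complete (here refl))

    P : Fin count → Set
    P j = enum j ∈ X
    ¬Pk : ¬ P k
    ¬Pk = z∉X ∘ subst (_∈ X) gk≡z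

    locate : ∀ {x} → x ∈ X → ∃ λ j → P j × enum j ≡ x
    locate x∈X with complete (there (∈-++⁺ˡ x∈X))
    ... | j , refl = j , x∈X , refl

    T∈C : InC 𝓕 (induced A enum)
    T∈C = induced-InC injective

    realised : ∃ λ d → IsOEmbedding (freeCopy (induced A enum) k P) A (d ∷ᵥ enum)
    realised = realise (freeCopy (induced A enum) k P)
                 (freeCopy-InC {T = induced A enum} allRelated ¬Pk T∈C)
                 (IsOEmbedding-∘ {T = induced A enum} {R = A}
                   (freeCopy-restrict {T = induced A enum} {k} {P}) (induced-isOEmbedding A injective))
    d : D
    d = proj₁ realised
    open Realisation (proj₂ realised)

lemma8p7 : (nU nB : ℕ) (I : Set) (𝓕 : I → FinStr nU nB) →
    (∀ i → AllRelated (st (𝓕 i))) →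
    (∀ (n : ℕ) (S : Str nU nB (Fin n)) → InForb 𝓕 S → Irreflexive S) →
    (D : Set) (A : OStr nU nB D) → IsFraisseLimit 𝓕 A →
    (X Y : List D) (z : D) → Disjoint X Y → z ∉ X → z ∉ Y →
    Σ (D → D) (λ τ → Automorphism A τ
      × (∀ x → x ∈ X → τ x ≡ x)
      × (∀ y → y ∈ Y → Unrelated (str A) (τ z) y)
      × Unrelated (str A) (τ z) z
      × lt A z (τ z))
lemma8p7 nU nB I 𝓕 allRelated _ D A lim X Y z X#Y z∉X _ =
    τ , automorphism , fixes-X
  , (λ y y∈Y → at-τz (λ w → Unrelated (str A) w y) (unrelated-Y y∈Y (λ y∈X → X#Y y y∈X y∈Y)))
  , at-τz (λ w → Unrelated (str A) w z) unrelated-z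
  , at-τz (lt A z) above
  where
  open FraisseLimit lim
  open FreeCopy (freeCopyOver allRelated X Y z∉X)

  moved : Σ (D → D) λ τ → Automorphism A τ × (∀ x → x ∈ X → τ x ≡ x) × τ z ≡ copy
  moved = moveOver z∉X copy∉X sameType

  τ : D → D
  τ = proj₁ moved
  automorphism : Automorphism A τ
  automorphism = proj₁ (proj₂ moved)
  fixes-X : ∀ x → x ∈ X → τ x ≡ x
  fixes-X = proj₁ (proj₂ (proj₂ moved))

  at-τz : (Q : D → Set) → Q copy → Q (τ z)
  at-τz Q = subst Q (sym (proj₂ (proj₂ (proj₂ moved))))
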